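{- Let $G=(V,E_G)$ be a finite connected simple graph and let $E,F\in V$ be two distinct non-adjacent vertices. Let $G'=(V,E_G\cup\{EF\})$ be the graph obtained by adding the edge $EF$. Write $AB:=d_G(A,B)$ for the graph distance in $G$. For a vertex $A$ let $R_A=\{Z\in V : d_{G'}(Z,A)<d_G(Z,A)\}$ (the special region of $A$), and let $N=\{Z\in V : R_Z=\emptyset\}$ (the normal region). Then $$R_E=\{A\in V : AE-AF>1\},\qquad N=\{A\in V : |AE-AF|\le 1\},\qquad R_F=\{A\in V: AE-AF<-1\},$$ and these three sets partition $V$.
   Context: Graph distance $d_H(A,B)$ is the number of edges in a shortest path between $A$ and $B$ in $H$. -}

module Defs where

open import Data.Nat using (ℕ; zero; suc; _≤_)
open import Data.Fin using (Fin)
open import Data.Product using (_×_; ∃)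
open import Data.Sum using (_⊎_)
open import Data.Empty using (⊥)
open import Relation.Nullary using (¬_)
open import Relation.Binary.PropositionalEquality using (_≡_)
open import Data.Integer as ℤ using (ℤ; +_; _-_)

record SimpleGraph (n : ℕ) : Set₁ where
  field
    Adj    : Fin n → Fin n → Set
    sym    : ∀ {x y} → Adj x y → Adj y x
    irrefl : ∀ {x} → ¬ Adj x x
open SimpleGraph public

data Walk {n : ℕ} (R : Fin n → Fin n → Set) : Fin n → Fin n → ℕ → Set where
  here : ∀ {a} → Walk R a a zero
  step : ∀ {a b c k} → R a b → Walk R b c k → Walk R a c (suc k)

Connected : ∀ {n} → SimpleGraph n → Set
Connected {n} G = ∀ (a b : Fin n) → ∃ λ k → Walk (Adj G) a b k

IsDistance : ∀ {n} → SimpleGraph n → (Fin n → Fin n → ℕ) → Set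
IsDistance {n} G d =
  ∀ (a b : Fin n) → Walk (Adj G) a b (d a b) × (∀ k → Walk (Adj G) a b k → d a b ≤ k)

AddedAdj : ∀ {n} → SimpleGraph n → Fin n → Fin n → Fin n → Fin n → Set
AddedAdj G E F x y = Adj G x y ⊎ ((x ≡ E × y ≡ F) ⊎ (x ≡ F × y ≡ E))

addEdge : ∀ {n} (G : SimpleGraph n) (E F : Fin n) → ¬ E ≡ F → SimpleGraph n
addEdge G E F E≢F = record
  { Adj = AddedAdj G E F
  ; sym = sy
  ; irrefl = irr
  }
  where
  open import Data.Sum using (inj₁; inj₂)
  open import Data.Product using (_,_)
  open import Relation.Binary.PropositionalEquality using (refl; trans) renaming (sym to ≡-sym)
  sy : ∀ {x y} → AddedAdj G E F x y → AddedAdj G E F y x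
  sy (inj₁ a) = inj₁ (SimpleGraph.sym G a)
  sy (inj₂ (inj₁ (p , q))) = inj₂ (inj₂ (q , p))
  sy (inj₂ (inj₂ (p , q))) = inj₂ (inj₁ (q , p))
  irr : ∀ {x} → ¬ AddedAdj G E F x x
  irr (inj₁ a) = SimpleGraph.irrefl G a
  irr (inj₂ (inj₁ (p , q))) = E≢F (trans (≡-sym p) q)
  irr (inj₂ (inj₂ (p , q))) = E≢F (trans (≡-sym q) p)

SpecialRegion : ∀ {n} → (d d' : Fin n → Fin n → ℕ) → Fin n → Fin n → Set
SpecialRegion d d' A Z = d' Z A Data.Nat.< d Z A

NormalRegion : ∀ {n} → (d d' : Fin n → Fin n → ℕ) → Fin n → Set
NormalRegion d d' Z = ∀ Y → ¬ SpecialRegion d d' Z Y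

diff : ∀ {n} → (Fin n → Fin n → ℕ) → Fin n → Fin n → Fin n → ℤ
diff d E F A = (+ d A E) - (+ d A F)

{-# OPTIONS --safe #-}
-- A walk from Z to A in G + EF either stays in G, so is at least ZA long, or crosses the new edge
-- in some direction U → V, so is at least ZU + 1 + VA long.  Hence d'(Z,A) < d(Z,A) exactly when
-- ZU + 1 + VA < ZA for an orientation (U,V) of EF.  For A = E only V = E can help, giving
-- Z ∈ R_E iff ZF + 1 < ZE; and if |AE − AF| ≤ 1 then ZU + 1 + VA ≥ ZU + UA ≥ ZA by the triangle
-- inequality, so no Z is closer to A in G + EF and A is normal.
module Submission where

open import Defs
open import Data.Nat using (ℕ)
open import Data.Fin using (Fin)
open import Data.Product using (_×_)
open import Data.Sum using (_⊎_)
open import Relation.Nullary using (¬_)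
open import Relation.Binary.PropositionalEquality using (_≡_)
open import Function.Bundles using (_⇔_)
open import Data.Integer using (ℤ; +_; -_; _<_; _≤_; ∣_∣)

open import Data.Nat as ℕ using (zero; suc; _+_; z≤n; s≤s; s≤s⁻¹; _<?_)
open import Data.Nat.Properties
open import Data.Integer using (_⊖_; +<+; +≤+)
open import Data.Integer.Properties using ([1+m]⊖[1+n]≡m⊖n; [+m]-[+n]≡m⊖n; ⊖-swap; neg-mono-<; neg-cancel-<)
open import Data.Product using (∃₂; _,_; proj₁; proj₂)
open import Data.Sum as ⊎ using (inj₁; inj₂)
open import Relation.Nullary using (yes; no; contradiction)
open import Relation.Binary.Definitions using (Symmetric)
open import Relation.Binary.PropositionalEquality using (refl; cong; subst; subst₂; module ≡-Reasoning)
  renaming (sym to ≡-sym)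
open import Function.Bundles using (mk⇔; module Equivalence)
import Function.Properties.Equivalence as ⇔

module _ {n} {R : Fin n → Fin n → Set} where

  _++_ : ∀ {a b c k m} → Walk R a b k → Walk R b c m → Walk R a c (k + m)
  here     ++ w = w
  step r v ++ w = step r (v ++ w)

  _∷ʳ_ : ∀ {a b c k} → Walk R a b k → R b c → Walk R a c (suc k)
  here     ∷ʳ r = step r here
  step s w ∷ʳ r = step s (w ∷ʳ r)

  reverse : Symmetric R → ∀ {a b k} → Walk R a b k → Walk R b a k
  reverse sym here       = here
  reverse sym (step r w) = reverse sym w ∷ʳ sym r

  map : ∀ {S : Fin n → Fin n → Set} → (∀ {x y} → R x y → S x y) → ∀ {a b k} → Walk R a b k → Walk S a b k
  map f here       = here
  map f (step r w) = step (f r) (map f w)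

module Distance {n} (H : SimpleGraph n) {d : Fin n → Fin n → ℕ} (isD : IsDistance H d) where

  shortest : ∀ a b → Walk (Adj H) a b (d a b)
  shortest a b = proj₁ (isD a b)

  minimal : ∀ {a b k} → Walk (Adj H) a b k → d a b ℕ.≤ k
  minimal {a} {b} {k} = proj₂ (isD a b) k

  dist-refl : ∀ a → d a a ≡ 0
  dist-refl a = n≤0⇒n≡0 (minimal here)

  dist-sym : ∀ a b → d a b ≡ d b a
  dist-sym a b = ≤-antisym (sym≤ a b) (sym≤ b a)
    where
    sym≤ : ∀ a b → d a b ℕ.≤ d b a
    sym≤ a b = minimal (reverse (SimpleGraph.sym H) (shortest b a))

  dist-triangle : ∀ a b c → d a c ℕ.≤ d a b + d b c
  dist-triangle a b c = minimal (shortest a b ++ shortest b c)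

  dist-adj : ∀ {a b} → Adj H a b → ∀ c → d a c ℕ.≤ suc (d b c)
  dist-adj {a} {b} r c = minimal (step r (shortest b c))

band-trichotomy : ∀ a b → suc b ℕ.< a ⊎ (a ℕ.≤ suc b × b ℕ.≤ suc a) ⊎ suc a ℕ.< b
band-trichotomy a b with suc b <? a | suc a <? b
... | yes above | _        = inj₁ above
... | no _      | yes below = inj₂ (inj₂ below)
... | no ¬above | no ¬below = inj₂ (inj₁ (≮⇒≥ ¬above , ≮⇒≥ ¬below))

1<m⊖n⇔1+n<m : ∀ m n → + 1 < m ⊖ n ⇔ suc n ℕ.< m
1<m⊖n⇔1+n<m zero    zero    = mk⇔ (λ { (+<+ ()) }) λ ()
1<m⊖n⇔1+n<m zero    (suc n) = mk⇔ (λ ()) λ ()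
1<m⊖n⇔1+n<m (suc m) zero    = mk⇔ (λ { (+<+ p) → p }) +<+
1<m⊖n⇔1+n<m (suc m) (suc n) rewrite [1+m]⊖[1+n]≡m⊖n m n =
  ⇔.trans (1<m⊖n⇔1+n<m m n) (mk⇔ s≤s s≤s⁻¹)

m⊖n<-1⇔1+m<n : ∀ m n → m ⊖ n < - + 1 ⇔ suc m ℕ.< n
m⊖n<-1⇔1+m<n m n rewrite ⊖-swap m n =
  ⇔.trans (mk⇔ neg-cancel-< neg-mono-<) (1<m⊖n⇔1+n<m n m)

∣m⊖n∣≤1⇔m≤1+n×n≤1+m : ∀ m n → + ∣ m ⊖ n ∣ ≤ + 1 ⇔ (m ℕ.≤ suc n × n ℕ.≤ suc m)
∣m⊖n∣≤1⇔m≤1+n×n≤1+m zero          zero          = mk⇔ (λ _ → z≤n , z≤n) (λ _ → +≤+ z≤n)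
∣m⊖n∣≤1⇔m≤1+n×n≤1+m zero          (suc zero)    = mk⇔ (λ _ → z≤n , s≤s z≤n) (λ _ → +≤+ (s≤s z≤n))
∣m⊖n∣≤1⇔m≤1+n×n≤1+m zero          (suc (suc n)) = mk⇔ (λ { (+≤+ (s≤s ())) }) λ { (_ , s≤s ()) }
∣m⊖n∣≤1⇔m≤1+n×n≤1+m (suc zero)    zero          = mk⇔ (λ _ → s≤s z≤n , z≤n) (λ _ → +≤+ (s≤s z≤n))
∣m⊖n∣≤1⇔m≤1+n×n≤1+m (suc (suc m)) zero          = mk⇔ (λ { (+≤+ (s≤s ())) }) λ { (s≤s () , _) }
∣m⊖n∣≤1⇔m≤1+n×n≤1+m (suc m)       (suc n) rewrite [1+m]⊖[1+n]≡m⊖n m n =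
  ⇔.trans (∣m⊖n∣≤1⇔m≤1+n×n≤1+m m n)
          (mk⇔ (λ (p , q) → s≤s p , s≤s q) (λ (p , q) → s≤s⁻¹ p , s≤s⁻¹ q))

module AddedEdge {n} (G : SimpleGraph n) (E F : Fin n) (E≢F : ¬ E ≡ F)
                 {d d' : Fin n → Fin n → ℕ}
                 (isD : IsDistance G d) (isD' : IsDistance (addEdge G E F E≢F) d') where

  private
    module D  = Distance G isD
    module D' = Distance (addEdge G E F E≢F) isD'

  data NewEdge : Fin n → Fin n → Set where
    EF : NewEdge E F
    FE : NewEdge F E

  new-adj : ∀ {u v} → NewEdge u v → AddedAdj G E F u v
  new-adj EF = inj₂ (inj₁ (refl , refl))
  new-adj FE = inj₂ (inj₂ (refl , refl))

  -- Length of the walk x ⇝ u → v ⇝ y made of two G-geodesics and the new edge.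
  via : Fin n → Fin n → Fin n → Fin n → ℕ
  via u v x y = d x u + suc (d v y)

  via-from-endpoint : ∀ u v y → via u v u y ≡ suc (d v y)
  via-from-endpoint u v y = cong (_+ suc (d v y)) (D.dist-refl u)

  via-to-endpoint : ∀ u v x → via u v x v ≡ suc (d x u)
  via-to-endpoint u v x = begin
    d x u + suc (d v v) ≡⟨ cong (λ t → d x u + suc t) (D.dist-refl v) ⟩
    d x u + 1           ≡⟨ +-comm (d x u) 1 ⟩
    suc (d x u)         ∎
    where open ≡-Reasoning

  dist≤via-returning : ∀ u v y → d u y ℕ.≤ via u v v y
  dist≤via-returning u v y = begin
    d u y                 ≤⟨ D.dist-triangle u v y ⟩
    d u v + d v y         ≡⟨ cong (_+ d v y) (D.dist-sym u v) ⟩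
    d v u + d v y         ≤⟨ +-monoʳ-≤ (d v u) (n≤1+n (d v y)) ⟩
    d v u + suc (d v y)   ∎
    where open ≤-Reasoning

  dist≤via : ∀ u v x y → d v y ℕ.≤ via u v x y
  dist≤via u v x y = ≤-trans (n≤1+n (d v y)) (m≤n+m (suc (d v y)) (d x u))

  via-not-shorter : ∀ {u v x y} → d u y ℕ.≤ suc (d v y) → ¬ via u v x y ℕ.< d x y
  via-not-shorter {u} {v} {x} {y} u-near shorter = <⇒≱ shorter (begin
    d x y               ≤⟨ D.dist-triangle x u y ⟩
    d x u + d u y       ≤⟨ +-monoʳ-≤ (d x u) u-near ⟩
    d x u + suc (d v y) ∎)
    where open ≤-Reasoning

  d'≤via : ∀ {u v} → NewEdge u v → ∀ x y → d' x y ℕ.≤ via u v x y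
  d'≤via {u} {v} e x y =
    D'.minimal (map inj₁ (D.shortest x u) ++ step (new-adj e) (map inj₁ (D.shortest v y)))

  ShortcutBound : Fin n → Fin n → ℕ → Set
  ShortcutBound x y k = d x y ℕ.≤ k ⊎ ∃₂ λ u v → NewEdge u v × via u v x y ℕ.≤ k

  old-edge : ∀ {a b y k} → Adj G a b → ShortcutBound b y k → ShortcutBound a y (suc k)
  old-edge {y = y} r (inj₁ p) = inj₁ (≤-trans (D.dist-adj r y) (s≤s p))
  old-edge {y = y} r (inj₂ (u , v , e , p)) =
    inj₂ (u , v , e , ≤-trans (+-monoˡ-≤ (suc (d v y)) (D.dist-adj r u)) (s≤s p))

  new-edge : ∀ {u v y k} → NewEdge u v → ShortcutBound v y k → ShortcutBound u y (suc k)
  new-edge {u} {v} {y} e (inj₁ p) =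
    inj₂ (u , v , e , ≤-trans (≤-reflexive (via-from-endpoint u v y)) (s≤s p))
  new-edge {u} {v} {y} e (inj₂ (_ , _ , e′ , p)) =
    inj₁ (≤-trans (leaving e e′) (≤-trans p (n≤1+n _)))
    where
    leaving : ∀ {u v u′ v′} → NewEdge u v → NewEdge u′ v′ → d u y ℕ.≤ via u′ v′ v y
    leaving EF EF = dist≤via-returning E F y
    leaving EF FE = dist≤via F E F y
    leaving FE FE = dist≤via-returning F E y
    leaving FE EF = dist≤via E F E y

  walk-bound : ∀ {x y k} → Walk (AddedAdj G E F) x y k → ShortcutBound x y k
  walk-bound {x} here                            = inj₁ (≤-reflexive (D.dist-refl x))
  walk-bound (step (inj₁ r) w)                   = old-edge r (walk-bound w)
  walk-bound (step (inj₂ (inj₁ (refl , refl))) w) = new-edge EF (walk-bound w)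
  walk-bound (step (inj₂ (inj₂ (refl , refl))) w) = new-edge FE (walk-bound w)

  shortened⇔ : ∀ x y → d' x y ℕ.< d x y ⇔ (∃₂ λ u v → NewEdge u v × via u v x y ℕ.< d x y)
  shortened⇔ x y = mk⇔ to from
    where
    to : d' x y ℕ.< d x y → ∃₂ λ u v → NewEdge u v × via u v x y ℕ.< d x y
    to shorter with walk-bound (D'.shortest x y)
    ... | inj₁ p               = contradiction p (<⇒≱ shorter)
    ... | inj₂ (u , v , e , p) = u , v , e , ≤-<-trans p shorter
    from : (∃₂ λ u v → NewEdge u v × via u v x y ℕ.< d x y) → d' x y ℕ.< d x y
    from (u , v , e , p) = ≤-<-trans (d'≤via e x y) p

  special-sym : ∀ {x y} → SpecialRegion d d' x y → SpecialRegion d d' y x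
  special-sym {x} {y} = subst₂ ℕ._<_ (D'.dist-sym y x) (D.dist-sym y x)

  special⇔ : ∀ {u v} → NewEdge u v → ∀ A → SpecialRegion d d' v A ⇔ suc (d A u) ℕ.< d A v
  special⇔ {u} {v} e A = mk⇔ to from
    where
    entering : ∀ {u v u′ v′} → NewEdge u v → NewEdge u′ v′ →
               via u′ v′ A v ℕ.< d A v → suc (d A u) ℕ.< d A v
    entering {u} {v} EF EF p = subst (ℕ._< d A v) (via-to-endpoint u v A) p
    entering {u} {v} FE FE p = subst (ℕ._< d A v) (via-to-endpoint u v A) p
    entering {v = v} EF FE p = contradiction (m≤m+n (d A v) _) (<⇒≱ p)
    entering {v = v} FE EF p = contradiction (m≤m+n (d A v) _) (<⇒≱ p)
    to : SpecialRegion d d' v A → suc (d A u) ℕ.< d A v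
    to shorter with Equivalence.to (shortened⇔ A v) shorter
    ... | _ , _ , e′ , p = entering e e′ p
    from : suc (d A u) ℕ.< d A v → SpecialRegion d d' v A
    from h = ≤-<-trans (d'≤via e A v) (subst (ℕ._< d A v) (≡-sym (via-to-endpoint u v A)) h)

  normal⇔ : ∀ A → NormalRegion d d' A ⇔ (d A E ℕ.≤ suc (d A F) × d A F ℕ.≤ suc (d A E))
  normal⇔ A = mk⇔ to from
    where
    to : NormalRegion d d' A → d A E ℕ.≤ suc (d A F) × d A F ℕ.≤ suc (d A E)
    to normal = ≮⇒≥ (λ h → normal E (special-sym (Equivalence.from (special⇔ FE A) h)))
              , ≮⇒≥ (λ h → normal F (special-sym (Equivalence.from (special⇔ EF A) h)))
    from : d A E ℕ.≤ suc (d A F) × d A F ℕ.≤ suc (d A E) → NormalRegion d d' A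
    from (AE≤ , AF≤) Y shorter with Equivalence.to (shortened⇔ Y A) shorter
    ... | _ , _ , EF , p = via-not-shorter (subst₂ ℕ._≤_ (D.dist-sym A E) (cong suc (D.dist-sym A F)) AE≤) p
    ... | _ , _ , FE , p = via-not-shorter (subst₂ ℕ._≤_ (D.dist-sym A F) (cong suc (D.dist-sym A E)) AF≤) p

  regions-partition : ∀ A →
      (SpecialRegion d d' E A ⊎ (NormalRegion d d' A ⊎ SpecialRegion d d' F A))
    × (¬ (SpecialRegion d d' E A × NormalRegion d d' A))
    × (¬ (SpecialRegion d d' E A × SpecialRegion d d' F A))
    × (¬ (NormalRegion d d' A × SpecialRegion d d' F A))
  regions-partition A = cover , E∩N , E∩F , N∩F
    where
    open Equivalence
    cover = ⊎.map (from (special⇔ FE A)) (⊎.map (from (normal⇔ A)) (from (special⇔ EF A)))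
                  (band-trichotomy (d A E) (d A F))
    E∩N = λ (inE , normal) → <⇒≱ (to (special⇔ FE A) inE) (proj₁ (to (normal⇔ A) normal))
    E∩F = λ (inE , inF) → <-asym (<-trans (n<1+n _) (to (special⇔ FE A) inE))
                                  (<-trans (n<1+n _) (to (special⇔ EF A) inF))
    N∩F = λ (normal , inF) → <⇒≱ (to (special⇔ EF A) inF) (proj₂ (to (normal⇔ A) normal))

claim1 : ∀ {n : ℕ} (G : SimpleGraph n) → Connected G →
    (E F : Fin n) (E≢F : ¬ E ≡ F) → ¬ Adj G E F →
    (d d' : Fin n → Fin n → ℕ) →
    IsDistance G d → IsDistance (addEdge G E F E≢F) d' →
    (∀ A → SpecialRegion d d' E A ⇔ (+ 1 < diff d E F A))
    × (∀ A → NormalRegion d d' A ⇔ (+ ∣ diff d E F A ∣ ≤ + 1))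
    × (∀ A → SpecialRegion d d' F A ⇔ (diff d E F A < - (+ 1)))
    × (∀ A → (SpecialRegion d d' E A ⊎ (NormalRegion d d' A ⊎ SpecialRegion d d' F A))
             × (¬ (SpecialRegion d d' E A × NormalRegion d d' A))
             × (¬ (SpecialRegion d d' E A × SpecialRegion d d' F A))
             × (¬ (NormalRegion d d' A × SpecialRegion d d' F A)))
claim1 G _ E F E≢F _ d d' isD isD' = regionE , regionN , regionF , regions-partition
  where
  open AddedEdge G E F E≢F isD isD'

  diff≡⊖ : ∀ A → diff d E F A ≡ d A E ⊖ d A F
  diff≡⊖ A = [+m]-[+n]≡m⊖n (d A E) (d A F)

  regionE : ∀ A → SpecialRegion d d' E A ⇔ (+ 1 < diff d E F A)
  regionE A rewrite diff≡⊖ A = ⇔.trans (special⇔ FE A) (⇔.sym (1<m⊖n⇔1+n<m _ _))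

  regionN : ∀ A → NormalRegion d d' A ⇔ (+ ∣ diff d E F A ∣ ≤ + 1)
  regionN A rewrite diff≡⊖ A = ⇔.trans (normal⇔ A) (⇔.sym (∣m⊖n∣≤1⇔m≤1+n×n≤1+m _ _))

  regionF : ∀ A → SpecialRegion d d' F A ⇔ (diff d E F A < - (+ 1))
  regionF A rewrite diff≡⊖ A = ⇔.trans (special⇔ EF A) (⇔.sym (m⊖n<-1⇔1+m<n _ _))
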